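{- For $n>0$, the number of regular elements of the Heyting algebra $\mathcal{D}_n^A$ is $2^{n-1}$.
   Context: $D_n^A$: words of length $2n$ over $\{u,r\}$ with $n$ $u$'s and $n$ $r$'s in which every prefix has at least as many $u$'s as $r$'s. Height sequence $(h_1,\dots,h_n)$: $h_i$ is the number of $u$'s preceding the $i$-th $r$. $\mathcal{D}_n^A$ is $D_n^A$ ordered componentwise by height sequences, a finite distributive lattice and hence a Heyting algebra. The pseudocomplement $x^{\mathsf c}$ is the greatest $z$ with $x\wedge z=\hat0$; $x$ is regular if $(x^{\mathsf c})^{\mathsf c}=x$. -}

module Defs where

open import Data.Bool using (Bool; true; false; _∧_; _∨_; not; if_then_else_)
open import Data.Nat using (ℕ; zero; suc; _+_; _≤ᵇ_; _≡ᵇ_)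
open import Data.List using (List; []; _∷_; map; _++_; length)

-- Letters: true = u (up), false = r (right).
Letter : Set
Letter = Bool

Word : Set
Word = List Letter

allWords : ℕ → List Word
allWords zero = [] ∷ []
allWords (suc m) = map (true ∷_) (allWords m) ++ map (false ∷_) (allWords m)

-- Dyck condition: every prefix has #u ≥ #r, and #u = #r overall.
-- d = (#u − #r) of the prefix read so far.
dyckFrom : ℕ → Word → Bool
dyckFrom d [] = d ≡ᵇ 0
dyckFrom d (true ∷ w) = dyckFrom (suc d) w
dyckFrom zero (false ∷ w) = false
dyckFrom (suc d) (false ∷ w) = dyckFrom d w

isDyck : Word → Bool
isDyck = dyckFrom 0

filterᵇ : {A : Set} → (A → Bool) → List A → List A
filterᵇ p [] = []
filterᵇ p (x ∷ xs) = if p x then x ∷ filterᵇ p xs else filterᵇ p xs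

anyᵇ : {A : Set} → (A → Bool) → List A → Bool
anyᵇ p [] = false
anyᵇ p (x ∷ xs) = p x ∨ anyᵇ p xs

allᵇ : {A : Set} → (A → Bool) → List A → Bool
allᵇ p [] = true
allᵇ p (x ∷ xs) = p x ∧ allᵇ p xs

countᵇ : {A : Set} → (A → Bool) → List A → ℕ
countᵇ p xs = length (filterᵇ p xs)

D : ℕ → List Word
D n = filterᵇ isDyck (allWords (n + n))

heightsFrom : ℕ → Word → List ℕ
heightsFrom k [] = []
heightsFrom k (true ∷ w) = heightsFrom (suc k) w
heightsFrom k (false ∷ w) = k ∷ heightsFrom k w

heights : Word → List ℕ
heights = heightsFrom 0

leqList : List ℕ → List ℕ → Bool
leqList [] [] = true
leqList (a ∷ as) (b ∷ bs) = (a ≤ᵇ b) ∧ leqList as bs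
leqList _ _ = false

_≼_ : Word → Word → Bool
x ≼ y = leqList (heights x) (heights y)

eqWord : Word → Word → Bool
eqWord [] [] = true
eqWord (true ∷ x) (true ∷ y) = eqWord x y
eqWord (false ∷ x) (false ∷ y) = eqWord x y
eqWord _ _ = false

module Lattice (n : ℕ) where
  isBottom : Word → Bool
  isBottom b = allᵇ (λ v → b ≼ v) (D n)

  isMeet : Word → Word → Word → Bool
  isMeet x z m = (m ≼ x) ∧ (m ≼ z)
    ∧ allᵇ (λ w → not ((w ≼ x) ∧ (w ≼ z)) ∨ (w ≼ m)) (D n)

  meetIsBottom : Word → Word → Bool
  meetIsBottom x z = anyᵇ (λ m → isMeet x z m ∧ isBottom m) (D n)

  isPseudocomplement : Word → Word → Bool
  isPseudocomplement x c = meetIsBottom x c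
    ∧ allᵇ (λ z → not (meetIsBottom x z) ∨ (z ≼ c)) (D n)

  isRegular : Word → Bool
  isRegular x = anyᵇ (λ c → isPseudocomplement x c
      ∧ anyᵇ (λ cc → isPseudocomplement c cc ∧ eqWord cc x) (D n)) (D n)

  numRegular : ℕ
  numRegular = countᵇ isRegular (D n)

open Lattice public

-- Height sequences of 𝒟ₙ are the nondecreasing sequences with i ≤ hᵢ and hₙ = n, ordered
-- componentwise; meets are componentwise minima and 0̂ is the staircase hᵢ = i.  So x ∧ z = 0̂
-- iff at each position one of x, z touches the diagonal, and xᶜ is the highest sequence touching
-- the diagonal wherever x does not: the "pyramid" over the positions where x is off the diagonal.
-- Taking pseudocomplements twice gives the pyramid over the fixed points of x, so x is regular
-- iff every hᵢ equals i or hᵢ₊₁, i.e. iff the word x is a concatenation of blocks uᵃrᵃ (a ≥ 1).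
-- Such words correspond to compositions of n, and there are 2ⁿ⁻¹ of them.

module Submission where

open import Defs
open import Data.Bool using (Bool; true; false; _∧_; _∨_; not; T)
open import Data.Bool.Properties using (T-≡; T-∧; T-∨; not-involutive; ∨-zeroʳ; ∧-zeroʳ)
open import Data.Empty using (⊥-elim)
open import Data.List using (List; []; _∷_; map; _++_; length; replicate; zipWith)
open import Data.List.Membership.Propositional using (_∈_)
open import Data.List.Membership.Propositional.Properties
  using (∈-map⁺; ∈-map⁻; ∈-++⁺ˡ; ∈-++⁺ʳ; ∈-++⁻)
open import Data.List.Properties using (∷-injectiveˡ; length-map; length-zipWith)
open import Data.List.Relation.Binary.Pointwise
  using (Pointwise; []; _∷_; transitive; antisymmetric; Pointwise-≡⇒≡)
open import Data.List.Relation.Unary.Any using (here; there)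
open import Data.Nat using (ℕ; zero; suc; pred; _+_; _≤_; _<_; _⊓_; _≡ᵇ_; _^_; _∸_; s≤s)
open import Data.Nat.Properties
open import Data.Product using (_×_; _,_; proj₁; proj₂; ∃)
open import Data.Sum using (_⊎_; inj₁; inj₂)
open import Data.Unit using (tt)
open import Function using (_∘_; Equivalence)
open import Relation.Binary.PropositionalEquality

open Equivalence using (to; from)

T-injective : ∀ {a b} → (T a → T b) → (T b → T a) → a ≡ b
T-injective {false} {false} _ _ = refl
T-injective {false} {true}  _ g = ⊥-elim (g tt)
T-injective {true}  {false} f _ = ⊥-elim (f tt)
T-injective {true}  {true}  _ _ = refl

T-implies⁺ : ∀ {a b} → (T a → T b) → T (not a ∨ b)
T-implies⁺ {false} _ = tt
T-implies⁺ {true}  f = f tt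

T-implies⁻ : ∀ {a b} → T (not a ∨ b) → T a → T b
T-implies⁻ {true} t _ = t

≡ᵇ-refl : ∀ m → (m ≡ᵇ m) ≡ true
≡ᵇ-refl m = to T-≡ (≡⇒≡ᵇ m m refl)

≢⇒≡ᵇ-false : ∀ {m n} → m ≢ n → (m ≡ᵇ n) ≡ false
≢⇒≡ᵇ-false {m} {n} m≢n with m ≡ᵇ n in eq
... | true  = ⊥-elim (m≢n (≡ᵇ⇒≡ m n (subst T (sym eq) tt)))
... | false = refl

module _ {A : Set} {p : A → Bool} where

  anyᵇ⁺ : ∀ {x xs} → x ∈ xs → T (p x) → T (anyᵇ p xs)
  anyᵇ⁺ (here refl)  px = from T-∨ (inj₁ px)
  anyᵇ⁺ (there x∈xs) px = from T-∨ (inj₂ (anyᵇ⁺ x∈xs px))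

  anyᵇ⁻ : ∀ xs → T (anyᵇ p xs) → ∃ λ x → x ∈ xs × T (p x)
  anyᵇ⁻ (y ∷ ys) t with to (T-∨ {p y}) t
  ... | inj₁ py = y , here refl , py
  ... | inj₂ t′ with anyᵇ⁻ ys t′
  ...   | x , x∈ys , px = x , there x∈ys , px

  allᵇ⁺ : ∀ xs → (∀ {x} → x ∈ xs → T (p x)) → T (allᵇ p xs)
  allᵇ⁺ []       _ = tt
  allᵇ⁺ (y ∷ ys) f = from T-∧ (f (here refl) , allᵇ⁺ ys (f ∘ there))

  allᵇ⁻ : ∀ {x xs} → T (allᵇ p xs) → x ∈ xs → T (p x)
  allᵇ⁻ t (here refl)  = proj₁ (to T-∧ t)
  allᵇ⁻ t (there x∈xs) = allᵇ⁻ (proj₂ (to (T-∧ {p _}) t)) x∈xs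

  ∈-filterᵇ⁺ : ∀ {x xs} → x ∈ xs → T (p x) → x ∈ filterᵇ p xs
  ∈-filterᵇ⁺ {xs = y ∷ ys} x∈ px with p y in eq | x∈
  ... | true  | here refl = here refl
  ... | true  | there x∈ys = there (∈-filterᵇ⁺ x∈ys px)
  ... | false | here refl = ⊥-elim (subst T eq px)
  ... | false | there x∈ys = ∈-filterᵇ⁺ x∈ys px

  ∈-filterᵇ⁻ : ∀ {x} xs → x ∈ filterᵇ p xs → x ∈ xs × T (p x)
  ∈-filterᵇ⁻ (y ∷ ys) x∈ with p y in eq
  ∈-filterᵇ⁻ (y ∷ ys) (here refl) | true = here refl , subst T (sym eq) tt
  ∈-filterᵇ⁻ (y ∷ ys) (there x∈) | true with ∈-filterᵇ⁻ ys x∈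
  ... | x∈ys , px = there x∈ys , px
  ∈-filterᵇ⁻ (y ∷ ys) x∈ | false with ∈-filterᵇ⁻ ys x∈
  ... | x∈ys , px = there x∈ys , px

module _ {A : Set} where

  countᵇ-filterᵇ : ∀ (p q : A → Bool) xs → countᵇ p (filterᵇ q xs) ≡ countᵇ (λ x → q x ∧ p x) xs
  countᵇ-filterᵇ p q [] = refl
  countᵇ-filterᵇ p q (x ∷ xs) with q x
  ... | false = countᵇ-filterᵇ p q xs
  ... | true with p x
  ...   | true  = cong suc (countᵇ-filterᵇ p q xs)
  ...   | false = countᵇ-filterᵇ p q xs

  countᵇ-cong : ∀ {p q : A → Bool} xs → (∀ {x} → x ∈ xs → p x ≡ q x) → countᵇ p xs ≡ countᵇ q xs
  countᵇ-cong [] _ = refl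
  countᵇ-cong {p} {q} (x ∷ xs) eq with p x | q x | eq (here refl)
  ... | true  | true  | _ = cong suc (countᵇ-cong xs (eq ∘ there))
  ... | false | false | _ = countᵇ-cong xs (eq ∘ there)

  countᵇ-++ : ∀ (p : A → Bool) xs ys → countᵇ p (xs ++ ys) ≡ countᵇ p xs + countᵇ p ys
  countᵇ-++ p [] ys = refl
  countᵇ-++ p (x ∷ xs) ys with p x
  ... | true  = cong suc (countᵇ-++ p xs ys)
  ... | false = countᵇ-++ p xs ys

  countᵇ-map : ∀ {B : Set} (p : B → Bool) (f : A → B) xs → countᵇ p (map f xs) ≡ countᵇ (p ∘ f) xs
  countᵇ-map p f [] = refl
  countᵇ-map p f (x ∷ xs) with p (f x)
  ... | true  = cong suc (countᵇ-map p f xs)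
  ... | false = countᵇ-map p f xs

  countᵇ-false : ∀ xs → countᵇ {A = A} (λ _ → false) xs ≡ 0
  countᵇ-false []       = refl
  countᵇ-false (x ∷ xs) = countᵇ-false xs

eqWord-refl : ∀ w → T (eqWord w w)
eqWord-refl []          = tt
eqWord-refl (true ∷ w)  = eqWord-refl w
eqWord-refl (false ∷ w) = eqWord-refl w

eqWord⇒≡ : ∀ x y → T (eqWord x y) → x ≡ y
eqWord⇒≡ []          []          _ = refl
eqWord⇒≡ (true ∷ x)  (true ∷ y)  t = cong (true ∷_) (eqWord⇒≡ x y t)
eqWord⇒≡ (false ∷ x) (false ∷ y) t = cong (false ∷_) (eqWord⇒≡ x y t)

∈-allWords : ∀ w → w ∈ allWords (length w)
∈-allWords []          = here refl
∈-allWords (true ∷ w)  = ∈-++⁺ˡ (∈-map⁺ (true ∷_) (∈-allWords w))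
∈-allWords (false ∷ w) =
  ∈-++⁺ʳ (map (true ∷_) (allWords (length w))) (∈-map⁺ (false ∷_) (∈-allWords w))

∈-allWords⁻ : ∀ {w} m → w ∈ allWords m → length w ≡ m
∈-allWords⁻ zero    (here refl) = refl
∈-allWords⁻ (suc m) w∈ with ∈-++⁻ (map (true ∷_) (allWords m)) w∈
... | inj₁ w∈ᵘ with ∈-map⁻ (true ∷_) w∈ᵘ
...   | v , v∈ , refl = cong suc (∈-allWords⁻ m v∈)
∈-allWords⁻ (suc m) w∈ | inj₂ w∈ʳ with ∈-map⁻ (false ∷_) w∈ʳ
...   | v , v∈ , refl = cong suc (∈-allWords⁻ m v∈)

-- Dyck words and their height sequences

-- `HeightSeq k q hs`: hs continues the height sequence of a Dyck path whose q-th r was at height k.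
HeightSeq : ℕ → ℕ → List ℕ → Set
HeightSeq k q []       = k ≡ q
HeightSeq k q (h ∷ hs) = k ≤ h × q < h × HeightSeq h (suc q) hs

HeightSeq-weaken : ∀ {k k′ q h hs} → k ≤ k′ → HeightSeq k′ q (h ∷ hs) → HeightSeq k q (h ∷ hs)
HeightSeq-weaken k≤k′ (k′≤h , q<h , rest) = ≤-trans k≤k′ k′≤h , q<h , rest

dyckFrom-suc-without-r : ∀ d k w → heightsFrom k w ≡ [] → dyckFrom (suc d) w ≡ false
dyckFrom-suc-without-r d k []         _  = refl
dyckFrom-suc-without-r d k (true ∷ w) eq = dyckFrom-suc-without-r (suc d) (suc k) w eq

heightsFrom-head-≥ : ∀ k w {h hs} → heightsFrom k w ≡ h ∷ hs → k ≤ h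
heightsFrom-head-≥ k (true ∷ w)  eq   = ≤-trans (n≤1+n k) (heightsFrom-head-≥ (suc k) w eq)
heightsFrom-head-≥ k (false ∷ w) refl = ≤-refl

heightsFrom-HeightSeq : ∀ d q k w → T (dyckFrom d w) → d + q ≡ k → HeightSeq k q (heightsFrom k w)
heightsFrom-HeightSeq zero    q k []          _  d+q≡k = sym d+q≡k
heightsFrom-HeightSeq d       q k (true ∷ w)  dw d+q≡k with heightsFrom (suc k) w in eq
... | []     = ⊥-elim (subst T (dyckFrom-suc-without-r d (suc k) w eq) dw)
... | h ∷ hs = HeightSeq-weaken (n≤1+n k)
  (subst (HeightSeq (suc k) q) eq (heightsFrom-HeightSeq (suc d) q (suc k) w dw (cong suc d+q≡k)))
heightsFrom-HeightSeq (suc d) q k (false ∷ w) dw d+q≡k =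
  ≤-refl , subst (q <_) d+q≡k (s≤s (m≤n+m q d)) ,
  heightsFrom-HeightSeq d (suc q) k w dw (trans (+-suc d q) d+q≡k)

length-heightsFrom : ∀ d k w → T (dyckFrom d w) →
  d + length w ≡ length (heightsFrom k w) + length (heightsFrom k w)
length-heightsFrom zero    k []          _  = refl
length-heightsFrom d       k (true ∷ w)  dw =
  trans (+-suc d (length w)) (length-heightsFrom (suc d) (suc k) w dw)
length-heightsFrom (suc d) k (false ∷ w) dw = cong suc (begin
  d + suc (length w) ≡⟨ +-suc d (length w) ⟩
  suc (d + length w) ≡⟨ cong suc (length-heightsFrom d k w dw) ⟩
  suc (r + r)        ≡⟨ sym (+-suc r r) ⟩
  r + suc r          ∎)
  where
  open ≡-Reasoning
  r = length (heightsFrom k w)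

fromHeights : ℕ → List ℕ → Word
fromHeights k []       = []
fromHeights k (h ∷ hs) = replicate (h ∸ k) true ++ false ∷ fromHeights h hs

heightsFrom-replicate : ∀ k m w → heightsFrom k (replicate m true ++ w) ≡ heightsFrom (m + k) w
heightsFrom-replicate k zero    w = refl
heightsFrom-replicate k (suc m) w =
  trans (heightsFrom-replicate (suc k) m w) (cong (λ j → heightsFrom j w) (+-suc m k))

dyckFrom-replicate : ∀ d m w → dyckFrom d (replicate m true ++ w) ≡ dyckFrom (m + d) w
dyckFrom-replicate d zero    w = refl
dyckFrom-replicate d (suc m) w =
  trans (dyckFrom-replicate (suc d) m w) (cong (λ j → dyckFrom j w) (+-suc m d))

heightsFrom-fromHeights : ∀ k q hs → HeightSeq k q hs → heightsFrom k (fromHeights k hs) ≡ hs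
heightsFrom-fromHeights k q []       _ = refl
heightsFrom-fromHeights k q (h ∷ hs) (k≤h , _ , rest)
  rewrite heightsFrom-replicate k (h ∸ k) (false ∷ fromHeights h hs) | m∸n+n≡m k≤h =
  cong (h ∷_) (heightsFrom-fromHeights h (suc q) hs rest)

dyckFrom-fromHeights : ∀ d q k hs → HeightSeq k q hs → d + q ≡ k → T (dyckFrom d (fromHeights k hs))
dyckFrom-fromHeights zero    q k [] _   _     = tt
dyckFrom-fromHeights (suc d) q k [] k≡q d+q≡k = ⊥-elim (m≢1+n+m q (sym (trans d+q≡k k≡q)))
dyckFrom-fromHeights d q k (h ∷ hs) (k≤h , q<h , rest) d+q≡k
  rewrite dyckFrom-replicate d (h ∸ k) (false ∷ fromHeights h hs) = descend ((h ∸ k) + d) climbed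
  where
  open ≡-Reasoning
  climbed : (h ∸ k) + d + q ≡ h
  climbed = begin
    (h ∸ k) + d + q   ≡⟨ +-assoc (h ∸ k) d q ⟩
    (h ∸ k) + (d + q) ≡⟨ cong ((h ∸ k) +_) d+q≡k ⟩
    (h ∸ k) + k       ≡⟨ m∸n+n≡m k≤h ⟩
    h                 ∎
  descend : ∀ t → t + q ≡ h → T (dyckFrom t (false ∷ fromHeights h hs))
  descend zero    q≡h   = ⊥-elim (<-irrefl q≡h q<h)
  descend (suc t) t+q≡h = dyckFrom-fromHeights t (suc q) h hs rest (trans (+-suc t q) t+q≡h)

+-double-injective : ∀ m n → m + m ≡ n + n → m ≡ n
+-double-injective zero    zero    _  = refl
+-double-injective (suc m) (suc n) eq = cong suc (+-double-injective m n
  (suc-injective (trans (sym (+-suc m m)) (trans (suc-injective eq) (+-suc n n)))))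

Heights : ℕ → List ℕ → Set
Heights n hs = HeightSeq 0 0 hs × length hs ≡ n

heights-fromHeights : ∀ {hs} → HeightSeq 0 0 hs → heights (fromHeights 0 hs) ≡ hs
heights-fromHeights = heightsFrom-fromHeights 0 0 _

-- The componentwise order, its least element and meets

infix 4 _≤ₛ_
_≤ₛ_ : List ℕ → List ℕ → Set
_≤ₛ_ = Pointwise _≤_

≤ₛ-trans : ∀ {X Y Z} → X ≤ₛ Y → Y ≤ₛ Z → X ≤ₛ Z
≤ₛ-trans = transitive ≤-trans

≤ₛ-antisym : ∀ {X Y} → X ≤ₛ Y → Y ≤ₛ X → X ≡ Y
≤ₛ-antisym X≤Y Y≤X = Pointwise-≡⇒≡ (antisymmetric ≤-antisym X≤Y Y≤X)

leqList⇒≤ₛ : ∀ X Y → T (leqList X Y) → X ≤ₛ Y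
leqList⇒≤ₛ []       []       _ = []
leqList⇒≤ₛ (x ∷ X) (y ∷ Y) t with to T-∧ t
... | x≤y , X≤Y = ≤ᵇ⇒≤ x y x≤y ∷ leqList⇒≤ₛ X Y X≤Y

≤ₛ⇒leqList : ∀ {X Y} → X ≤ₛ Y → T (leqList X Y)
≤ₛ⇒leqList []                = tt
≤ₛ⇒leqList (_∷_ {x} {y} x≤y X≤Y) = from T-∧ (≤⇒≤ᵇ x≤y , ≤ₛ⇒leqList X≤Y)

≼⇒≤ₛ : ∀ x y → T (x ≼ y) → heights x ≤ₛ heights y
≼⇒≤ₛ x y = leqList⇒≤ₛ (heights x) (heights y)

staircase : ℕ → ℕ → List ℕ
staircase i zero    = []
staircase i (suc m) = i ∷ staircase (suc i) m

length-staircase : ∀ i m → length (staircase i m) ≡ m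
length-staircase i zero    = refl
length-staircase i (suc m) = cong suc (length-staircase (suc i) m)

staircase-HeightSeq : ∀ q m → HeightSeq q q (staircase (suc q) m)
staircase-HeightSeq q zero    = refl
staircase-HeightSeq q (suc m) = n≤1+n q , ≤-refl , staircase-HeightSeq (suc q) m

staircase-≤ₛ : ∀ {k q} hs → HeightSeq k q hs → staircase (suc q) (length hs) ≤ₛ hs
staircase-≤ₛ []       _                 = []
staircase-≤ₛ (h ∷ hs) (_ , q<h , rest) = q<h ∷ staircase-≤ₛ hs rest

infixl 7 _⊓ₛ_
_⊓ₛ_ : List ℕ → List ℕ → List ℕ
_⊓ₛ_ = zipWith _⊓_

⊓ₛ-lowerˡ : ∀ X Z → length X ≡ length Z → X ⊓ₛ Z ≤ₛ X
⊓ₛ-lowerˡ []      []      _  = []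
⊓ₛ-lowerˡ (x ∷ X) (z ∷ Z) eq = m⊓n≤m x z ∷ ⊓ₛ-lowerˡ X Z (suc-injective eq)

⊓ₛ-lowerʳ : ∀ X Z → length X ≡ length Z → X ⊓ₛ Z ≤ₛ Z
⊓ₛ-lowerʳ []      []      _  = []
⊓ₛ-lowerʳ (x ∷ X) (z ∷ Z) eq = m⊓n≤n x z ∷ ⊓ₛ-lowerʳ X Z (suc-injective eq)

⊓ₛ-greatest : ∀ {W X Z} → W ≤ₛ X → W ≤ₛ Z → W ≤ₛ X ⊓ₛ Z
⊓ₛ-greatest []            []            = []
⊓ₛ-greatest (w≤x ∷ W≤X) (w≤z ∷ W≤Z) = ⊓-glb w≤x w≤z ∷ ⊓ₛ-greatest W≤X W≤Z

⊓ₛ-HeightSeq : ∀ {k k′ q} X Z → length X ≡ length Z → HeightSeq k q X → HeightSeq k′ q Z →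
  HeightSeq (k ⊓ k′) q (X ⊓ₛ Z)
⊓ₛ-HeightSeq {k} []      []      _  refl refl = ⊓-idem k
⊓ₛ-HeightSeq (x ∷ X) (z ∷ Z) eq (k≤x , q<x , X-seq) (k′≤z , q<z , Z-seq) =
  ⊓-mono-≤ k≤x k′≤z , ⊓-glb q<x q<z , ⊓ₛ-HeightSeq X Z (suc-injective eq) X-seq Z-seq

⊓ₛ-Heights : ∀ {n X Z} → Heights n X → Heights n Z → Heights n (X ⊓ₛ Z)
⊓ₛ-Heights {n} {X} {Z} (X-seq , lX) (Z-seq , lZ) =
  ⊓ₛ-HeightSeq X Z (trans lX (sym lZ)) X-seq Z-seq ,
  trans (length-zipWith _⊓_ X Z) (trans (cong₂ _⊓_ lX lZ) (⊓-idem n))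

staircase-Heights : ∀ n → Heights n (staircase 1 n)
staircase-Heights n = staircase-HeightSeq 0 n , length-staircase 1 n

staircase-least : ∀ {n X} → Heights n X → staircase 1 n ≤ₛ X
staircase-least {X = X} (X-seq , refl) = staircase-≤ₛ X X-seq

-- Pyramids and pseudocomplements

fixedPoints : ℕ → List ℕ → List Bool
fixedPoints i []       = []
fixedPoints i (h ∷ hs) = (h ≡ᵇ i) ∷ fixedPoints (suc i) hs

-- `pyramid i s`, with positions numbered from i, is the largest height sequence touching the
-- diagonal at every position marked in s; past the end, `pred i` is the last position, where
-- every height sequence touches the diagonal.
nextMark : ℕ → List Bool → ℕ
nextMark i []          = pred i
nextMark i (true ∷ s)  = i
nextMark i (false ∷ s) = nextMark (suc i) s

pyramid : ℕ → List Bool → List ℕ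
pyramid i []      = []
pyramid i (b ∷ s) = nextMark i (b ∷ s) ∷ pyramid (suc i) s

-- x ∧ z = 0̂ forces z onto the diagonal wherever x is off it.
pseudocomplementFrom : ℕ → List ℕ → List ℕ
pseudocomplementFrom i X = pyramid i (map not (fixedPoints i X))

pseudocomplement : List ℕ → List ℕ
pseudocomplement = pseudocomplementFrom 1

nextMark-≥ : ∀ i b s → i ≤ nextMark i (b ∷ s)
nextMark-≥ i true  s       = ≤-refl
nextMark-≥ i false []      = ≤-refl
nextMark-≥ i false (c ∷ s) = ≤-trans (n≤1+n i) (nextMark-≥ (suc i) c s)

pyramid-HeightSeq : ∀ k q s → k ≡ q ⊎ k ≡ nextMark (suc q) s → HeightSeq k q (pyramid (suc q) s)
pyramid-HeightSeq k q []      (inj₁ k≡q) = k≡q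
pyramid-HeightSeq k q []      (inj₂ k≡q) = k≡q
pyramid-HeightSeq k q (b ∷ s) k≡        =
  k≤head k≡ , nextMark-≥ (suc q) b s , pyramid-HeightSeq _ (suc q) s (tail-start b)
  where
  k≤head : k ≡ q ⊎ k ≡ nextMark (suc q) (b ∷ s) → k ≤ nextMark (suc q) (b ∷ s)
  k≤head (inj₁ refl) = ≤-trans (n≤1+n k) (nextMark-≥ (suc k) b s)
  k≤head (inj₂ k≡)  = ≤-reflexive k≡
  tail-start : ∀ b →
    nextMark (suc q) (b ∷ s) ≡ suc q ⊎ nextMark (suc q) (b ∷ s) ≡ nextMark (suc (suc q)) s
  tail-start true  = inj₁ refl
  tail-start false = inj₂ refl

length-pyramid : ∀ i s → length (pyramid i s) ≡ length s
length-pyramid i []      = refl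
length-pyramid i (b ∷ s) = cong suc (length-pyramid (suc i) s)

length-fixedPoints : ∀ i X → length (fixedPoints i X) ≡ length X
length-fixedPoints i []      = refl
length-fixedPoints i (h ∷ X) = cong suc (length-fixedPoints (suc i) X)

pseudocomplement-Heights : ∀ {n} X → length X ≡ n → Heights n (pseudocomplement X)
pseudocomplement-Heights X length≡n = pyramid-HeightSeq 0 0 _ (inj₁ refl) ,
  trans (length-pyramid 1 (map not (fixedPoints 1 X)))
        (trans (length-map not (fixedPoints 1 X)) (trans (length-fixedPoints 1 X) length≡n))

⊓ₛ-pseudocomplementFrom : ∀ i X → X ⊓ₛ pseudocomplementFrom i X ≤ₛ staircase i (length X)
⊓ₛ-pseudocomplementFrom i []      = []
⊓ₛ-pseudocomplementFrom i (h ∷ X) with h ≡ᵇ i in h≡ᵇi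
... | true  = ≤-trans (m⊓n≤m h _) (≤-reflexive (≡ᵇ⇒≡ h i (subst T (sym h≡ᵇi) tt)))
            ∷ ⊓ₛ-pseudocomplementFrom (suc i) X
... | false = m⊓n≤n h i ∷ ⊓ₛ-pseudocomplementFrom (suc i) X

nextMark-upper : ∀ {kₓ} k q X Z → HeightSeq kₓ q X → HeightSeq k q Z → length X ≡ length Z →
  X ⊓ₛ Z ≤ₛ staircase (suc q) (length X) → k ≤ nextMark (suc q) (map not (fixedPoints (suc q) X))
nextMark-upper k q []      []      _ k≡q _  _ = ≤-reflexive k≡q
nextMark-upper k q (x ∷ X) (z ∷ Z) (_ , q<x , X-seq) (k≤z , _ , Z-seq) eq (x⊓z≤1+q ∷ rest)
  with x ≡ᵇ suc q in x≡ᵇ1+q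
... | true  = ≤-trans k≤z (nextMark-upper z (suc q) X Z X-seq Z-seq (suc-injective eq) rest)
... | false with ⊓-sel x z
...   | inj₂ x⊓z≡z = ≤-trans k≤z (subst (_≤ suc q) x⊓z≡z x⊓z≤1+q)
...   | inj₁ x⊓z≡x = ⊥-elim (subst T x≡ᵇ1+q
    (≡⇒≡ᵇ x (suc q) (≤-antisym (subst (_≤ suc q) x⊓z≡x x⊓z≤1+q) q<x)))

≤ₛ-pseudocomplementFrom : ∀ {kₓ k} q X Z → HeightSeq kₓ q X → HeightSeq k q Z → length X ≡ length Z →
  X ⊓ₛ Z ≤ₛ staircase (suc q) (length X) → Z ≤ₛ pseudocomplementFrom (suc q) X
≤ₛ-pseudocomplementFrom q []      []      _ _ _ _ = []
≤ₛ-pseudocomplementFrom q (x ∷ X) (z ∷ Z) X-seq@(_ , _ , X-seq′) (_ , q<z , Z-seq) eq meet≤@(_ ∷ rest) =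
  nextMark-upper z q (x ∷ X) (z ∷ Z) X-seq (≤-refl , q<z , Z-seq) eq meet≤ ∷
  ≤ₛ-pseudocomplementFrom (suc q) X Z X-seq′ Z-seq (suc-injective eq) rest

nextMark-last : ∀ i b → nextMark i (b ∷ []) ≡ i
nextMark-last i true  = refl
nextMark-last i false = refl

pseudocomplementFrom-pyramid : ∀ i s → pseudocomplementFrom i (pyramid i s) ≡ pyramid i (map not s)
pseudocomplementFrom-pyramid i []          = refl
pseudocomplementFrom-pyramid i (b ∷ [])    = cong (_∷ [])
  (trans (nextMark-last i (not (nextMark i (b ∷ []) ≡ᵇ i))) (sym (nextMark-last i (not b))))
pseudocomplementFrom-pyramid i (true ∷ c ∷ s) =
  let tail≡ = pseudocomplementFrom-pyramid (suc i) (c ∷ s)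
      rest  = map not (fixedPoints (suc i) (pyramid (suc i) (c ∷ s)))
  in cong₂ _∷_
       (trans (cong (λ fixed → nextMark i (not fixed ∷ rest)) (≡ᵇ-refl i)) (∷-injectiveˡ tail≡))
       tail≡
pseudocomplementFrom-pyramid i (false ∷ c ∷ s) =
  cong₂ _∷_
    (cong (λ fixed → nextMark i (not fixed ∷ rest)) (≢⇒≡ᵇ-false (>⇒≢ (nextMark-≥ (suc i) c s))))
    (pseudocomplementFrom-pyramid (suc i) (c ∷ s))
  where rest = map not (fixedPoints (suc i) (pyramid (suc i) (c ∷ s)))

map-not-involutive : ∀ s → map not (map not s) ≡ s
map-not-involutive []      = refl
map-not-involutive (b ∷ s) = cong₂ _∷_ (not-involutive b) (map-not-involutive s)

pseudocomplement-twice : ∀ X → pseudocomplement (pseudocomplement X) ≡ pyramid 1 (fixedPoints 1 X)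
pseudocomplement-twice X = trans (pseudocomplementFrom-pyramid 1 (map not (fixedPoints 1 X)))
  (cong (pyramid 1) (map-not-involutive (fixedPoints 1 X)))

⊓ₛ-pseudocomplement : ∀ {n X} → Heights n X → X ⊓ₛ pseudocomplement X ≤ₛ staircase 1 n
⊓ₛ-pseudocomplement {X = X} (_ , refl) = ⊓ₛ-pseudocomplementFrom 1 X

≤ₛ-pseudocomplement : ∀ {n X Z} → Heights n X → Heights n Z →
  X ⊓ₛ Z ≤ₛ staircase 1 n → Z ≤ₛ pseudocomplement X
≤ₛ-pseudocomplement {X = X} {Z} (X-seq , refl) (Z-seq , lZ) =
  ≤ₛ-pseudocomplementFrom 0 X Z X-seq Z-seq (sym lZ)

pyramidalᵇ : ℕ → List ℕ → Bool
pyramidalᵇ i (h ∷ h′ ∷ hs) = ((h ≡ᵇ i) ∨ (h ≡ᵇ h′)) ∧ pyramidalᵇ (suc i) (h′ ∷ hs)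
pyramidalᵇ i _             = true

pyramid-pyramidalᵇ : ∀ i s → T (pyramidalᵇ i (pyramid i s))
pyramid-pyramidalᵇ i []              = tt
pyramid-pyramidalᵇ i (b ∷ [])        = tt
pyramid-pyramidalᵇ i (true ∷ c ∷ s)  =
  from T-∧ (from T-∨ (inj₁ (≡⇒≡ᵇ i i refl)) , pyramid-pyramidalᵇ (suc i) (c ∷ s))
pyramid-pyramidalᵇ i (false ∷ c ∷ s) =
  from T-∧ (from T-∨ (inj₂ (≡⇒≡ᵇ h h refl)) , pyramid-pyramidalᵇ (suc i) (c ∷ s))
  where h = nextMark (suc i) (c ∷ s)

nextMark-fixedPoint : ∀ i h h′ s → T ((h ≡ᵇ i) ∨ (h ≡ᵇ h′)) → nextMark (suc i) s ≡ h′ →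
  nextMark i ((h ≡ᵇ i) ∷ s) ≡ h
nextMark-fixedPoint i h h′ s local next≡h′ with h ≡ᵇ i in h≡ᵇi
... | true  = sym (≡ᵇ⇒≡ h i (subst T (sym h≡ᵇi) tt))
... | false = trans next≡h′ (sym (≡ᵇ⇒≡ h h′ local))

pyramidalᵇ⇒pyramid-fixedPoints : ∀ {k} q X → HeightSeq k q X → T (pyramidalᵇ (suc q) X) →
  pyramid (suc q) (fixedPoints (suc q) X) ≡ X
pyramidalᵇ⇒pyramid-fixedPoints q []      _ _ = refl
pyramidalᵇ⇒pyramid-fixedPoints q (h ∷ []) (_ , _ , h≡1+q) _ =
  cong (_∷ []) (trans (nextMark-last (suc q) (h ≡ᵇ suc q)) (sym h≡1+q))
pyramidalᵇ⇒pyramid-fixedPoints q (h ∷ h′ ∷ X) (_ , _ , X-seq) t =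
  let local , rest = to T-∧ t
      tail≡ = pyramidalᵇ⇒pyramid-fixedPoints (suc q) (h′ ∷ X) X-seq rest
  in cong₂ _∷_ (nextMark-fixedPoint (suc q) h h′ _ local (∷-injectiveˡ tail≡)) tail≡

regular⇒pyramidalᵇ : ∀ X → pseudocomplement (pseudocomplement X) ≡ X → T (pyramidalᵇ 1 X)
regular⇒pyramidalᵇ X regular = subst (T ∘ pyramidalᵇ 1)
  (trans (sym (pseudocomplement-twice X)) regular) (pyramid-pyramidalᵇ 1 (fixedPoints 1 X))

pyramidalᵇ⇒regular : ∀ X → HeightSeq 0 0 X → T (pyramidalᵇ 1 X) →
  pseudocomplement (pseudocomplement X) ≡ X
pyramidalᵇ⇒regular X X-seq t =
  trans (pseudocomplement-twice X) (pyramidalᵇ⇒pyramid-fixedPoints 0 X X-seq t)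

-- The lattice 𝒟ₙ

module _ (n : ℕ) where

  ∈D⇒Heights : ∀ {w} → w ∈ D n → Heights n (heights w)
  ∈D⇒Heights {w} w∈ with ∈-filterᵇ⁻ (allWords (n + n)) w∈
  ... | w∈all , dw = heightsFrom-HeightSeq 0 0 0 w dw refl ,
    +-double-injective _ n (trans (sym (length-heightsFrom 0 0 w dw)) (∈-allWords⁻ (n + n) w∈all))

  Heights⇒fromHeights-∈D : ∀ {hs} → Heights n hs → fromHeights 0 hs ∈ D n
  Heights⇒fromHeights-∈D {hs} (seq , length≡n) =
    ∈-filterᵇ⁺ (subst (λ m → w ∈ allWords m) length≡2n (∈-allWords w)) dw
    where
    w  = fromHeights 0 hs
    dw = dyckFrom-fromHeights 0 0 0 hs seq refl
    length≡2n : length w ≡ n + n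
    length≡2n = trans (length-heightsFrom 0 0 w dw)
      (cong (λ m → m + m) (trans (cong length (heightsFrom-fromHeights 0 0 hs seq)) length≡n))

  isMeet-intro : ∀ x z m → T (m ≼ x) → T (m ≼ z) →
    (∀ {w} → w ∈ D n → T (w ≼ x) → T (w ≼ z) → T (w ≼ m)) → T (isMeet n x z m)
  isMeet-intro x z m m≼x m≼z greatest = from T-∧ (m≼x , from T-∧ (m≼z ,
    allᵇ⁺ {p = λ w → not ((w ≼ x) ∧ (w ≼ z)) ∨ (w ≼ m)} (D n)
      λ w∈ → T-implies⁺ λ below-both →
        greatest w∈ (proj₁ (to T-∧ below-both)) (proj₂ (to T-∧ below-both))))

  isMeet-greatest : ∀ x z m → T (isMeet n x z m) →
    ∀ {w} → w ∈ D n → T (w ≼ x) → T (w ≼ z) → T (w ≼ m)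
  isMeet-greatest x z m t w∈ w≼x w≼z =
    T-implies⁻ (allᵇ⁻ {p = λ w → not ((w ≼ x) ∧ (w ≼ z)) ∨ (w ≼ m)}
                      (proj₂ (to (T-∧ {m ≼ z}) (proj₂ (to (T-∧ {m ≼ x}) t)))) w∈)
               (from T-∧ (w≼x , w≼z))

  isPseudocomplement-intro : ∀ x c → T (meetIsBottom n x c) →
    (∀ {z} → z ∈ D n → T (meetIsBottom n x z) → T (z ≼ c)) → T (isPseudocomplement n x c)
  isPseudocomplement-intro x c disjoint greatest = from T-∧ (disjoint ,
    allᵇ⁺ {p = λ z → not (meetIsBottom n x z) ∨ (z ≼ c)} (D n) (T-implies⁺ ∘ greatest))

  isPseudocomplement-greatest : ∀ x c → T (isPseudocomplement n x c) →
    ∀ {z} → z ∈ D n → T (meetIsBottom n x z) → T (z ≼ c)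
  isPseudocomplement-greatest x c t z∈ = T-implies⁻
    (allᵇ⁻ {p = λ z → not (meetIsBottom n x z) ∨ (z ≼ c)}
           (proj₂ (to (T-∧ {meetIsBottom n x c}) t)) z∈)

  isRegular-intro : ∀ {x c} → x ∈ D n → c ∈ D n →
    T (isPseudocomplement n x c) → T (isPseudocomplement n c x) → T (isRegular n x)
  isRegular-intro {x} {c} x∈ c∈ x-c c-x = anyᵇ⁺ c∈ (from T-∧ (x-c ,
    anyᵇ⁺ {p = λ cc → isPseudocomplement n c cc ∧ eqWord cc x} x∈
          (from T-∧ (c-x , eqWord-refl x))))

  isRegular-elim : ∀ {x} → T (isRegular n x) →
    ∃ λ c → c ∈ D n × T (isPseudocomplement n x c) × T (isPseudocomplement n c x)
  isRegular-elim {x} t with anyᵇ⁻ (D n) t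
  ... | c , c∈ , t′ with to T-∧ t′
  ...   | x-c , some-cc with anyᵇ⁻ (D n) some-cc
  ...     | cc , _ , t″ with to T-∧ t″
  ...       | c-cc , cc≈x =
    c , c∈ , x-c , subst (T ∘ isPseudocomplement n c) (eqWord⇒≡ cc x cc≈x) c-cc

  bottom : Word
  bottom = fromHeights 0 (staircase 1 n)

  bottom-∈D : bottom ∈ D n
  bottom-∈D = Heights⇒fromHeights-∈D (staircase-Heights n)

  heights-bottom : heights bottom ≡ staircase 1 n
  heights-bottom = heights-fromHeights (staircase-HeightSeq 0 n)

  bottom-≼ : ∀ {v} → v ∈ D n → T (bottom ≼ v)
  bottom-≼ v∈ =
    ≤ₛ⇒leqList (subst (_≤ₛ _) (sym heights-bottom) (staircase-least (∈D⇒Heights v∈)))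

  meetIsBottom⁺ : ∀ {x z} → x ∈ D n → z ∈ D n →
    heights x ⊓ₛ heights z ≤ₛ staircase 1 n → T (meetIsBottom n x z)
  meetIsBottom⁺ {x} {z} x∈ z∈ meet≤ =
    anyᵇ⁺ bottom-∈D (from T-∧
      (isMeet-intro x z bottom (bottom-≼ x∈) (bottom-≼ z∈) below-bottom , allᵇ⁺ (D n) bottom-≼))
    where
    below-bottom : ∀ {w} → w ∈ D n → T (w ≼ x) → T (w ≼ z) → T (w ≼ bottom)
    below-bottom {w} _ w≼x w≼z = ≤ₛ⇒leqList (subst (_ ≤ₛ_) (sym heights-bottom)
      (≤ₛ-trans (⊓ₛ-greatest (≼⇒≤ₛ w x w≼x) (≼⇒≤ₛ w z w≼z)) meet≤))

  meetIsBottom⁻ : ∀ {x z} → x ∈ D n → z ∈ D n →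
    T (meetIsBottom n x z) → heights x ⊓ₛ heights z ≤ₛ staircase 1 n
  meetIsBottom⁻ {x} {z} x∈ z∈ t with anyᵇ⁻ (D n) t
  ... | m , _ , meet∧bottom with to T-∧ meet∧bottom
  ...   | isMeet-m , isBottom-m =
    ≤ₛ-trans (subst (_≤ₛ _) heights-meet (≼⇒≤ₛ meet m meet≼m))
             (subst (_ ≤ₛ_) heights-bottom (≼⇒≤ₛ m bottom (allᵇ⁻ isBottom-m bottom-∈D)))
    where
    X = heights x
    Z = heights z
    Hmeet = ⊓ₛ-Heights (∈D⇒Heights x∈) (∈D⇒Heights z∈)
    meet = fromHeights 0 (X ⊓ₛ Z)
    heights-meet : heights meet ≡ X ⊓ₛ Z
    heights-meet = heights-fromHeights (proj₁ Hmeet)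
    lengths : length X ≡ length Z
    lengths = trans (proj₂ (∈D⇒Heights x∈)) (sym (proj₂ (∈D⇒Heights z∈)))
    meet≼m : T (meet ≼ m)
    meet≼m = isMeet-greatest x z m isMeet-m (Heights⇒fromHeights-∈D Hmeet)
      (≤ₛ⇒leqList (subst (_≤ₛ X) (sym heights-meet) (⊓ₛ-lowerˡ X Z lengths)))
      (≤ₛ⇒leqList (subst (_≤ₛ Z) (sym heights-meet) (⊓ₛ-lowerʳ X Z lengths)))

  pseudocomplementWord : Word → Word
  pseudocomplementWord x = fromHeights 0 (pseudocomplement (heights x))

  pseudocomplementWord-∈D : ∀ {x} → x ∈ D n → pseudocomplementWord x ∈ D n
  pseudocomplementWord-∈D {x} x∈ =
    Heights⇒fromHeights-∈D (pseudocomplement-Heights (heights x) (proj₂ (∈D⇒Heights x∈)))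

  heights-pseudocomplementWord : ∀ {x} → x ∈ D n →
    heights (pseudocomplementWord x) ≡ pseudocomplement (heights x)
  heights-pseudocomplementWord {x} x∈ =
    heights-fromHeights (proj₁ (pseudocomplement-Heights (heights x) (proj₂ (∈D⇒Heights x∈))))

  meetIsBottom-pseudocomplement : ∀ {x c} → x ∈ D n → c ∈ D n →
    heights c ≡ pseudocomplement (heights x) → T (meetIsBottom n x c)
  meetIsBottom-pseudocomplement {x} x∈ c∈ c≡ = meetIsBottom⁺ x∈ c∈
    (subst (λ C → heights x ⊓ₛ C ≤ₛ staircase 1 n) (sym c≡) (⊓ₛ-pseudocomplement (∈D⇒Heights x∈)))

  isPseudocomplement⁺ : ∀ {x c} → x ∈ D n → c ∈ D n →
    heights c ≡ pseudocomplement (heights x) → T (isPseudocomplement n x c)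
  isPseudocomplement⁺ {x} {c} x∈ c∈ c≡ =
    isPseudocomplement-intro x c (meetIsBottom-pseudocomplement x∈ c∈ c≡) λ z∈ x∧z=0 →
      ≤ₛ⇒leqList (subst (_ ≤ₛ_) (sym c≡)
        (≤ₛ-pseudocomplement (∈D⇒Heights x∈) (∈D⇒Heights z∈) (meetIsBottom⁻ x∈ z∈ x∧z=0)))

  isPseudocomplement⁻ : ∀ {x c} → x ∈ D n → c ∈ D n →
    T (isPseudocomplement n x c) → heights c ≡ pseudocomplement (heights x)
  isPseudocomplement⁻ {x} {c} x∈ c∈ t = ≤ₛ-antisym
    (≤ₛ-pseudocomplement (∈D⇒Heights x∈) (∈D⇒Heights c∈) (meetIsBottom⁻ x∈ c∈ (proj₁ (to T-∧ t))))
    (subst (_≤ₛ _) (heights-pseudocomplementWord x∈) (≼⇒≤ₛ (pseudocomplementWord x) c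
      (isPseudocomplement-greatest x c t (pseudocomplementWord-∈D x∈)
        (meetIsBottom-pseudocomplement x∈ (pseudocomplementWord-∈D x∈) (heights-pseudocomplementWord x∈)))))

  isRegular⁺ : ∀ {x} → x ∈ D n →
    pseudocomplement (pseudocomplement (heights x)) ≡ heights x → T (isRegular n x)
  isRegular⁺ {x} x∈ regular = isRegular-intro x∈ c∈
    (isPseudocomplement⁺ x∈ c∈ (heights-pseudocomplementWord x∈))
    (isPseudocomplement⁺ c∈ x∈
      (sym (trans (cong pseudocomplement (heights-pseudocomplementWord x∈)) regular)))
    where c∈ = pseudocomplementWord-∈D x∈

  isRegular⁻ : ∀ {x} → x ∈ D n → T (isRegular n x) →
    pseudocomplement (pseudocomplement (heights x)) ≡ heights x
  isRegular⁻ {x} x∈ t with isRegular-elim t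
  ... | c , c∈ , x-c , c-x = sym (begin
    heights x                      ≡⟨ isPseudocomplement⁻ c∈ x∈ c-x ⟩
    pseudocomplement (heights c)    ≡⟨ cong pseudocomplement (isPseudocomplement⁻ x∈ c∈ x-c) ⟩
    pseudocomplement (pseudocomplement (heights x)) ∎)
    where open ≡-Reasoning

-- Regular words

-- `pyramids w`: w is a concatenation of blocks uᵃrᵃ with a ≥ 1.  Inside a block,
-- `pyramidsUp j` has read j + 1 u's and `pyramidsDown j` still expects j r's.
mutual
  pyramids : Word → Bool
  pyramids []          = true
  pyramids (true ∷ w)  = pyramidsUp 0 w
  pyramids (false ∷ w) = false

  pyramidsUp : ℕ → Word → Bool
  pyramidsUp j []          = false
  pyramidsUp j (true ∷ w)  = pyramidsUp (suc j) w
  pyramidsUp j (false ∷ w) = pyramidsDown j w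

  pyramidsDown : ℕ → Word → Bool
  pyramidsDown zero    w           = pyramids w
  pyramidsDown (suc j) []          = false
  pyramidsDown (suc j) (true ∷ w)  = false
  pyramidsDown (suc j) (false ∷ w) = pyramidsDown j w

pyramidalᵇ-ground : ∀ q hs → pyramidalᵇ q (q ∷ hs) ≡ pyramidalᵇ (suc q) hs
pyramidalᵇ-ground q []       = refl
pyramidalᵇ-ground q (h ∷ hs) rewrite ≡ᵇ-refl q = refl

pyramidalᵇ-repeat : ∀ q h hs → pyramidalᵇ q (h ∷ h ∷ hs) ≡ pyramidalᵇ (suc q) (h ∷ hs)
pyramidalᵇ-repeat q h hs rewrite ≡ᵇ-refl h | ∨-zeroʳ (h ≡ᵇ q) = refl

pyramidalᵇ-valley : ∀ {q k h} hs → k ≢ q → k ≢ h → pyramidalᵇ q (k ∷ h ∷ hs) ≡ false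
pyramidalᵇ-valley hs k≢q k≢h rewrite ≢⇒≡ᵇ-false k≢q | ≢⇒≡ᵇ-false k≢h = refl

mutual
  pyramids-heightsFrom : ∀ q w → pyramids w ≡ dyckFrom 0 w ∧ pyramidalᵇ (suc q) (heightsFrom q w)
  pyramids-heightsFrom q []          = refl
  pyramids-heightsFrom q (true ∷ w)  = pyramidsUp-heightsFrom 0 q w
  pyramids-heightsFrom q (false ∷ w) = refl

  pyramidsUp-heightsFrom : ∀ j q w →
    pyramidsUp j w ≡ dyckFrom (suc j) w ∧ pyramidalᵇ (suc q) (heightsFrom (suc j + q) w)
  pyramidsUp-heightsFrom j q []          = refl
  pyramidsUp-heightsFrom j q (true ∷ w)  = pyramidsUp-heightsFrom (suc j) q w
  pyramidsUp-heightsFrom j q (false ∷ w) rewrite sym (+-suc j q) = pyramidsDown-heightsFrom j (suc q) w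

  pyramidsDown-heightsFrom : ∀ j q w →
    pyramidsDown j w ≡ dyckFrom j w ∧ pyramidalᵇ q ((j + q) ∷ heightsFrom (j + q) w)
  pyramidsDown-heightsFrom zero    q w =
    trans (pyramids-heightsFrom q w) (cong (dyckFrom 0 w ∧_) (sym (pyramidalᵇ-ground q (heightsFrom q w))))
  pyramidsDown-heightsFrom (suc j) q []          = refl
  pyramidsDown-heightsFrom (suc j) q (true ∷ w) with heightsFrom (suc (suc j + q)) w in eq
  ... | []     = sym (cong (_∧ true) (dyckFrom-suc-without-r (suc j) _ w eq))
  ... | h ∷ hs = sym (trans (cong (dyckFrom (suc (suc j)) w ∧_)
                                  (pyramidalᵇ-valley hs (≢-sym (m≢1+n+m q)) (<⇒≢ (heightsFrom-head-≥ _ w eq))))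
                            (∧-zeroʳ _))
  pyramidsDown-heightsFrom (suc j) q (false ∷ w) = begin
    pyramidsDown j w
      ≡⟨ pyramidsDown-heightsFrom j (suc q) w ⟩
    dyckFrom j w ∧ pyramidalᵇ (suc q) ((j + suc q) ∷ heightsFrom (j + suc q) w)
      ≡⟨ cong (λ k → dyckFrom j w ∧ pyramidalᵇ (suc q) (k ∷ heightsFrom k w)) (+-suc j q) ⟩
    dyckFrom j w ∧ pyramidalᵇ (suc q) (suc (j + q) ∷ heightsFrom (suc (j + q)) w)
      ≡⟨ cong (dyckFrom j w ∧_) (sym (pyramidalᵇ-repeat q (suc (j + q)) (heightsFrom (suc (j + q)) w))) ⟩
    dyckFrom j w ∧ pyramidalᵇ q (suc (j + q) ∷ suc (j + q) ∷ heightsFrom (suc (j + q)) w)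
      ∎
    where open ≡-Reasoning

dyck∧regular≡pyramids : ∀ n w → length w ≡ n + n → isDyck w ∧ isRegular n w ≡ pyramids w
dyck∧regular≡pyramids n w length≡ = T-injective
  (λ t → let dw , reg = to T-∧ t in
    subst T (sym pyramids≡) (from T-∧ (dw , regular⇒pyramidalᵇ (heights w) (isRegular⁻ n (w∈ dw) reg))))
  (λ t → let dw , pyr = to T-∧ (subst T pyramids≡ t) in
    from T-∧ (dw , isRegular⁺ n (w∈ dw)
      (pyramidalᵇ⇒regular (heights w) (proj₁ (∈D⇒Heights n (w∈ dw))) pyr)))
  where
  pyramids≡ : pyramids w ≡ isDyck w ∧ pyramidalᵇ 1 (heights w)
  pyramids≡ = pyramids-heightsFrom 0 w
  w∈ : T (isDyck w) → w ∈ D n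
  w∈ = ∈-filterᵇ⁺ (subst (λ m → w ∈ allWords m) length≡ (∈-allWords w))

-- Counting

countWords : (Word → Bool) → ℕ → ℕ
countWords p m = countᵇ p (allWords m)

countWords-suc : ∀ p m →
  countWords p (suc m) ≡ countWords (p ∘ (true ∷_)) m + countWords (p ∘ (false ∷_)) m
countWords-suc p m = trans (countᵇ-++ p (map (true ∷_) (allWords m)) _)
  (cong₂ _+_ (countᵇ-map p (true ∷_) (allWords m)) (countᵇ-map p (false ∷_) (allWords m)))

countWords-false : ∀ m → countWords (λ _ → false) m ≡ 0
countWords-false m = countᵇ-false (allWords m)

evenPow2 : ℕ → ℕ
evenPow2 zero          = 1
evenPow2 (suc zero)    = 0
evenPow2 (suc (suc m)) = evenPow2 m + evenPow2 m

evenPow2-double : ∀ m → evenPow2 (m + m) ≡ 2 ^ m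
evenPow2-double zero    = refl
evenPow2-double (suc m) = begin
  evenPow2 (suc (m + suc m))          ≡⟨ cong (evenPow2 ∘ suc) (+-suc m m) ⟩
  evenPow2 (m + m) + evenPow2 (m + m) ≡⟨ cong (λ k → k + k) (evenPow2-double m) ⟩
  2 ^ m + 2 ^ m                       ≡⟨ cong (2 ^ m +_) (sym (+-identityʳ (2 ^ m))) ⟩
  2 ^ suc m                           ∎
  where open ≡-Reasoning

pyramidsDown-short : ∀ j m → m < j → countWords (pyramidsDown j) m ≡ 0
pyramidsDown-short (suc j) zero    _           = refl
pyramidsDown-short (suc j) (suc m) (s≤s m<j) = trans (countWords-suc (pyramidsDown (suc j)) m)
  (cong₂ _+_ (countWords-false m) (pyramidsDown-short j m m<j))

pyramidsDown-count : ∀ j m → countWords (pyramidsDown j) (j + m) ≡ countWords pyramids m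
pyramidsDown-count zero    m = refl
pyramidsDown-count (suc j) m = trans (countWords-suc (pyramidsDown (suc j)) (j + m))
  (cong₂ _+_ (countWords-false (j + m)) (pyramidsDown-count j m))

pyramidsUp-short : ∀ j m → m ≤ j → countWords (pyramidsUp j) m ≡ 0
pyramidsUp-short j zero    _     = refl
pyramidsUp-short j (suc m) 1+m≤j = trans (countWords-suc (pyramidsUp j) m)
  (cong₂ _+_ (pyramidsUp-short (suc j) m (m≤n⇒m≤1+n (<⇒≤ 1+m≤j))) (pyramidsDown-short j m 1+m≤j))

mutual
  pyramidsUp-count : ∀ j m → countWords (pyramidsUp j) (suc (j + m)) ≡ evenPow2 m
  pyramidsUp-count j zero = trans (countWords-suc (pyramidsUp j) (j + 0))
    (cong₂ _+_ (pyramidsUp-short (suc j) (j + 0) (≤-trans (≤-reflexive (+-identityʳ j)) (n≤1+n j)))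
               (pyramidsDown-count j 0))
  pyramidsUp-count j (suc zero) = trans (countWords-suc (pyramidsUp j) (j + 1))
    (cong₂ _+_ (pyramidsUp-short (suc j) (j + 1) (≤-reflexive (+-comm j 1))) (pyramidsDown-count j 1))
  pyramidsUp-count j (suc (suc m)) = begin
    countWords (pyramidsUp j) (suc (j + suc (suc m)))
      ≡⟨ countWords-suc (pyramidsUp j) (j + suc (suc m)) ⟩
    countWords (pyramidsUp (suc j)) (j + suc (suc m)) + countWords (pyramidsDown j) (j + suc (suc m))
      ≡⟨ cong₂ _+_ (cong (countWords (pyramidsUp (suc j))) (trans (+-suc j (suc m)) (cong suc (+-suc j m))))
                   (pyramidsDown-count j (suc (suc m))) ⟩
    countWords (pyramidsUp (suc j)) (suc (suc j + m)) + countWords pyramids (suc (suc m))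
      ≡⟨ cong₂ _+_ (pyramidsUp-count (suc j) m) (pyramids-count m) ⟩
    evenPow2 m + evenPow2 m
      ∎
    where open ≡-Reasoning

  pyramids-count : ∀ m → countWords pyramids (suc (suc m)) ≡ evenPow2 m
  pyramids-count m = begin
    countWords pyramids (suc (suc m))
      ≡⟨ countWords-suc pyramids (suc m) ⟩
    countWords (pyramidsUp 0) (suc m) + countWords (λ _ → false) (suc m)
      ≡⟨ cong₂ _+_ (pyramidsUp-count 0 m) (countWords-false (suc m)) ⟩
    evenPow2 m + 0
      ≡⟨ +-identityʳ _ ⟩
    evenPow2 m
      ∎
    where open ≡-Reasoning

corollary3p11 : (n : ℕ) → 0 < n → numRegular n ≡ 2 ^ (n ∸ 1)
corollary3p11 (suc m) _ = begin
  numRegular n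
    ≡⟨ countᵇ-filterᵇ (isRegular n) isDyck (allWords (n + n)) ⟩
  countWords (λ w → isDyck w ∧ isRegular n w) (n + n)
    ≡⟨ countᵇ-cong (allWords (n + n)) (λ w∈ → dyck∧regular≡pyramids n _ (∈-allWords⁻ (n + n) w∈)) ⟩
  countWords pyramids (n + n)
    ≡⟨ cong (countWords pyramids ∘ suc) (+-suc m m) ⟩
  countWords pyramids (suc (suc (m + m)))
    ≡⟨ pyramids-count (m + m) ⟩
  evenPow2 (m + m)
    ≡⟨ evenPow2-double m ⟩
  2 ^ m
    ∎
  where
  open ≡-Reasoning
  n = suc m
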